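{- Let $Q_{12}=\langle \sigma,\tau \mid \sigma^{6}=e,\ \tau^2=\sigma^{3},\ \tau^{ -1}\sigma\tau=\sigma^{ -1}\rangle$ and $S=\{\sigma,\sigma^{ -1},\tau,\tau^{ -1}\}$. In the Cayley graph $\Gamma(Q_{12},S)$, every type A edge $\{g,g\sigma\}$ ($g\in Q_{12}$) has Ricci curvature $\kappa=\frac14$, and every type B edge $\{g,g\tau\}$ ($g\in Q_{12}$) has Ricci curvature $\kappa=\frac12$.
   Context: Let $G=(V,E)$ be a finite connected simple undirected graph with graph distance $d$, $N(x)$ the set of neighbors of $x$, and $\deg(x)=|N(x)|$. For $\alpha\in[0,1]$ and $x\in V$ define the probability measure $\mu_x^\alpha$ on $V$ by $\mu_x^\alpha(x)=\alpha$, $\mu_x^\alpha(v)=\frac{1-\alpha}{\deg(x)}$ for $v\in N(x)$, and $\mu_x^\alpha(v)=0$ otherwise. For probability measures $\mu,\nu$ on $V$, the 1-Wasserstein distance is $W_1(\mu,\nu)=\inf_\pi\sum_{x,y\in V}d(x,y)\pi(x,y)$, the infimum over all $\pi:V\times V\to[0,1]$ with $\sum_y\pi(x,y)=\mu(x)$ and $\sum_x\pi(x,y)=\nu(y)$. For $x\neq y$, $\kappa_\alpha(x,y)=1-\frac{W_1(\mu_x^\alpha,\mu_y^\alpha)}{d(x,y)}$, and the Ricci curvature (of Lin–Lu–Yau) is $\kappa(x,y)=\lim_{\alpha\to1}\frac{\kappa_\alpha(x,y)}{1-\alpha}$. For a group $\mathcal G$ and a generating set $S$ with $e\notin S$ and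 $S=S^{ -1}$, the Cayley graph $\Gamma(\mathcal G,S)$ is the simple undirected graph with vertex set $\mathcal G$ and edge set $\{\{g,gs\}: g\in\mathcal G,\ s\in S\}$.
   Formalization: The parameter α in the limit $\alpha\to1$ and the transport plans π defining $W_1$ take rational values instead of real ones. -}

module Defs where

open import Data.Bool using (Bool; true; false; _∧_; _∨_; if_then_else_)
open import Data.Nat as ℕ using (ℕ; zero; suc)
open import Data.Nat.DivMod using (_mod_)
open import Data.Fin as Fin using (Fin; toℕ)
open import Data.Integer using (+_)
open import Data.Rational as ℚ using (ℚ; 0ℚ; 1ℚ; _+_; _*_; _-_; _÷_; ∣_∣; _<_; _≤_)

open import Data.List using (List; []; _∷_; foldr; map; length; cartesianProduct; allFin)
open import Data.Bool.ListAction using (any)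
open import Data.Product using (_×_; _,_; Σ; ∃; ∃-syntax)
open import Data.Product.Properties using (≡-dec)
open import Relation.Nullary using (Dec; yes; no; does)
open import Relation.Binary.PropositionalEquality using (_≡_)

-- Finite simple graphs, given by a finite vertex type with decidable
-- equality, a complete duplicate-free enumeration, and a Boolean
-- adjacency relation.

record FiniteGraph : Set₁ where
  field
    V      : Set
    _≟V_   : (x y : V) → Dec (x ≡ y)
    elems  : List V
    adj    : V → V → Bool

module GraphNotions (G : FiniteGraph) where
  open FiniteGraph G

  _==_ : V → V → Bool
  x == y = does (x ≟V y)

  sumV : (V → ℚ) → ℚ
  sumV f = foldr _+_ 0ℚ (map f elems)

  -- total division on ℚ (only used with nonzero denominators)
  _/'_ : ℚ → ℚ → ℚ
  p /' q with q ℚ.≟ 0ℚ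
  ... | yes _ = 0ℚ
  ... | no q≢0 = _÷_ p q {{ℚ.≢-nonZero q≢0}}

  ℕtoℚ : ℕ → ℚ
  ℕtoℚ n = (+ n) ℚ./ 1

  reach : ℕ → V → V → Bool
  reach zero x y = x == y
  reach (suc k) x y = reach k x y ∨ any (λ z → reach k x z ∧ adj z y) elems

  -- graph distance: least k with reach k x y (searched up to |V|)
  distFrom : ℕ → ℕ → V → V → ℕ
  distFrom k zero x y = k
  distFrom k (suc fuel) x y = if reach k x y then k else distFrom (suc k) fuel x y

  d : V → V → ℕ
  d x y = distFrom 0 (length elems) x y

  deg : V → ℕ
  deg x = foldr ℕ._+_ 0 (map (λ v → if adj x v then 1 else 0) elems)

  μ : ℚ → V → V → ℚ
  μ α x v = if x == v then α else (if adj x v then (1ℚ - α) /' ℕtoℚ (deg x) else 0ℚ)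

  IsCoupling : (V → ℚ) → (V → ℚ) → (V → V → ℚ) → Set
  IsCoupling m n π =
    (∀ x y → 0ℚ ≤ π x y) ×
    (∀ x → sumV (λ y → π x y) ≡ m x) ×
    (∀ y → sumV (λ x → π x y) ≡ n y)

  cost : (V → V → ℚ) → ℚ
  cost π = sumV (λ x → sumV (λ y → ℕtoℚ (d x y) * π x y))

  IsW1 : (V → ℚ) → (V → ℚ) → ℚ → Set
  IsW1 m n w =
    (∃[ π ] (IsCoupling m n π × cost π ≡ w)) ×
    (∀ π → IsCoupling m n π → w ≤ cost π)

  kappaAlpha : V → V → ℚ → ℚ
  kappaAlpha x y W = 1ℚ - (W /' ℕtoℚ (d x y))

  -- Lin–Lu–Yau Ricci curvature: κ(x,y) = lim_{α→1⁻} κ_α(x,y)/(1-α) = κ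
  RicciCurvatureIs : V → V → ℚ → Set
  RicciCurvatureIs x y κ =
    ∀ ε → 0ℚ < ε → ∃[ δ ] (0ℚ < δ ×
      (∀ α → 1ℚ - δ < α → α < 1ℚ →
        ∃[ W ] (IsW1 (μ α x) (μ α y) W ×
          ∣ (kappaAlpha x y W /' (1ℚ - α)) - κ ∣ < ε)))

CayleyGraph : (G : Set) → ((x y : G) → Dec (x ≡ y)) → List G →
              (G → G → G) → List G → FiniteGraph
CayleyGraph G dec els mul S = record
  { V = G ; _≟V_ = dec ; elems = els
  ; adj = λ g h → any (λ s → does (dec (mul g s) h)) S }

-- The dicyclic group Q₁₂ = ⟨σ,τ | σ⁶ = e, τ² = σ³, τ⁻¹στ = σ⁻¹⟩,
-- each element written uniquely in normal form σ^a τ^b (a < 6, b < 2).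

Q12 : Set
Q12 = Fin 6 × Fin 2

_≟Q_ : (x y : Q12) → Dec (x ≡ y)
_≟Q_ = ≡-dec Fin._≟_ Fin._≟_

Q12-elems : List Q12
Q12-elems = cartesianProduct (allFin 6) (allFin 2)

-- (σ^a τ^b)(σ^c τ^e) = σ^(a + (-1)^b c + 3[b=e=1]) τ^(b+e),
-- using τσ = σ⁻¹τ and τ² = σ³.
_·_ : Q12 → Q12 → Q12
(a , b) · (c , e) =
  ((toℕ a ℕ.+ (if toℕ b ℕ.≡ᵇ 0 then toℕ c else 6 ℕ.∸ toℕ c)
          ℕ.+ (if (toℕ b ℕ.≡ᵇ 1) ∧ (toℕ e ℕ.≡ᵇ 1) then 3 else 0)) mod 6
  , (toℕ b ℕ.+ toℕ e) mod 2)

σ σ⁻¹ τ τ⁻¹ : Q12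
σ   = (Fin.suc Fin.zero , Fin.zero)
σ⁻¹ = (Fin.fromℕ 5 , Fin.zero)
τ   = (Fin.zero , Fin.suc Fin.zero)
τ⁻¹ = (Fin.suc (Fin.suc (Fin.suc Fin.zero)) , Fin.suc Fin.zero)

S-Q12 : List Q12
S-Q12 = σ ∷ σ⁻¹ ∷ τ ∷ τ⁻¹ ∷ []

ΓQ12 : FiniteGraph
ΓQ12 = CayleyGraph Q12 _≟Q_ Q12-elems _·_ S-Q12

{-# OPTIONS --safe #-}

-- On every edge {x, y} of Γ(Q₁₂, S) and for α ∈ [½, 1), W₁(μ_x^α, μ_y^α) is
-- exactly 1 − κ(1 − α): a transport plan whose entries are affine in α gives
-- the upper bound, and a 1-Lipschitz potential gives the matching lower bound
-- by Kantorovich duality.  Hence κ_α/(1 − α) is constantly κ near α = 1.  The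
-- plan and potential on {g, gs} are the left translates by g of those on
-- {e, s}, and since every identity they must satisfy is affine in α, checking
-- it amounts to comparing finitely many rationals.

module Submission where

open import Defs
open import Data.Bool using (true; false; _∧_; if_then_else_)
open import Data.Bool.ListAction using (any)
open import Data.Empty using (⊥-elim)
open import Data.Fin using (zero)
open import Data.Integer using (+_)
open import Data.List using (List; []; _∷_; foldr; map)
open import Data.List.Membership.Propositional using (_∈_)
open import Data.List.Membership.Propositional.Properties
  using (∈-cartesianProduct⁺; ∈-allFin)
open import Data.List.Relation.Unary.All as All using (All; []; _∷_; all?)
import Data.Nat as ℕ
open import Data.Product using (_×_; _,_)
open import Data.Product.Properties using (≡-dec)
open import Data.Rational as ℚ
  using (ℚ; 0ℚ; 1ℚ; _+_; _*_; _-_; ½; -_; 1/_; ∣_∣; _<_; _≤_; _/_)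
import Data.Rational.Properties as ℚP
open import Data.Rational.Solver using (module +-*-Solver)
open import Relation.Nullary using (Dec; yes; no; does)
open import Relation.Nullary.Decidable using (_×-dec_; True; toWitness)
open import Relation.Binary.PropositionalEquality
  using (_≡_; _≢_; refl; sym; trans; cong; cong₂; subst; ≢-sym; module ≡-Reasoning)

open +-*-Solver
open ≡-Reasoning


0≤q-p : ∀ {p q} → p ≤ q → 0ℚ ≤ q - p
0≤q-p {p} {q} p≤q = subst (_≤ q - p) (ℚP.+-inverseʳ p) (ℚP.+-monoˡ-≤ (- p) p≤q)

0<q-p : ∀ {p q} → p < q → 0ℚ < q - p
0<q-p {p} {q} p<q = subst (_< q - p) (ℚP.+-inverseʳ p) (ℚP.+-monoˡ-< (- p) p<q)

0≤p*q : ∀ {p q} → 0ℚ ≤ p → 0ℚ ≤ q → 0ℚ ≤ p * q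
0≤p*q {p} {q} 0≤p 0≤q = ℚP.nonNegative⁻¹ (p * q)
  {{ℚP.nonNeg*nonNeg⇒nonNeg p {{ℚ.nonNegative 0≤p}} q {{ℚ.nonNegative 0≤q}}}}

0≤p+p : ∀ {p} → 0ℚ ≤ p → 0ℚ ≤ p + p
0≤p+p 0≤p = ℚP.+-mono-≤ 0≤p 0≤p

sumOver : {A : Set} → List A → (A → ℚ) → ℚ
sumOver xs f = foldr _+_ 0ℚ (map f xs)

module _ {A : Set} where

  sumOver-cong : ∀ (xs : List A) {f g} → (∀ x → f x ≡ g x) → sumOver xs f ≡ sumOver xs g
  sumOver-cong []       f≡g = refl
  sumOver-cong (x ∷ xs) f≡g = cong₂ _+_ (f≡g x) (sumOver-cong xs f≡g)

  sumOver-mono-≤ : ∀ (xs : List A) {f g} → (∀ x → f x ≤ g x) → sumOver xs f ≤ sumOver xs g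
  sumOver-mono-≤ []       f≤g = ℚP.≤-refl
  sumOver-mono-≤ (x ∷ xs) f≤g = ℚP.+-mono-≤ (f≤g x) (sumOver-mono-≤ xs f≤g)

  sumOver-zero : ∀ (xs : List A) → sumOver xs (λ _ → 0ℚ) ≡ 0ℚ
  sumOver-zero []       = refl
  sumOver-zero (x ∷ xs) = trans (ℚP.+-identityˡ _) (sumOver-zero xs)

  sumOver-+ : ∀ (xs : List A) f g →
              sumOver xs (λ x → f x + g x) ≡ sumOver xs f + sumOver xs g
  sumOver-+ []       f g = refl
  sumOver-+ (x ∷ xs) f g = trans (cong (λ s → (f x + g x) + s) (sumOver-+ xs f g))
    (solve 4 (λ a b c d → (a :+ b) :+ (c :+ d) := (a :+ c) :+ (b :+ d)) refl
      (f x) (g x) (sumOver xs f) (sumOver xs g))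

  sumOver-- : ∀ (xs : List A) f g →
              sumOver xs (λ x → f x - g x) ≡ sumOver xs f - sumOver xs g
  sumOver-- []       f g = refl
  sumOver-- (x ∷ xs) f g = trans (cong (λ s → (f x - g x) + s) (sumOver-- xs f g))
    (solve 4 (λ a b c d → (a :- b) :+ (c :- d) := (a :+ c) :- (b :+ d)) refl
      (f x) (g x) (sumOver xs f) (sumOver xs g))

  *-distribˡ-sumOver : ∀ c (xs : List A) f → c * sumOver xs f ≡ sumOver xs (λ x → c * f x)
  *-distribˡ-sumOver c []       f = ℚP.*-zeroʳ c
  *-distribˡ-sumOver c (x ∷ xs) f =
    trans (ℚP.*-distribˡ-+ c (f x) (sumOver xs f)) (cong (λ s → c * f x + s) (*-distribˡ-sumOver c xs f))

sumOver-comm : {A B : Set} (xs : List A) (ys : List B) (g : A → B → ℚ) →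
               sumOver xs (λ x → sumOver ys (g x)) ≡ sumOver ys (λ y → sumOver xs (λ x → g x y))
sumOver-comm []       ys g = sym (sumOver-zero ys)
sumOver-comm (x ∷ xs) ys g = trans (cong (λ s → sumOver ys (g x) + s) (sumOver-comm xs ys g))
  (sym (sumOver-+ ys (g x) (λ y → sumOver xs (λ x → g x y))))

Affine : Set
Affine = ℚ × ℚ

eval : Affine → ℚ → ℚ
eval (a , b) α = a + b * α

infixl 6 _⊕_ _⊖_
infixr 7 _⊛_
infix 4 _≟A_

_⊕_ _⊖_ : Affine → Affine → Affine
(a , b) ⊕ (c , d) = (a + c , b + d)
(a , b) ⊖ (c , d) = (a - c , b - d)

_⊛_ : ℚ → Affine → Affine
c ⊛ (a , b) = (c * a , c * b)

sumAff : {A : Set} → List A → (A → Affine) → Affine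
sumAff xs f = foldr _⊕_ (0ℚ , 0ℚ) (map f xs)

_≟A_ : (p q : Affine) → Dec (p ≡ q)
_≟A_ = ≡-dec ℚ._≟_ ℚ._≟_

eval-⊕ : ∀ p q α → eval (p ⊕ q) α ≡ eval p α + eval q α
eval-⊕ (a , b) (c , d) α =
  solve 5 (λ a b c d α → (a :+ c) :+ (b :+ d) :* α := (a :+ b :* α) :+ (c :+ d :* α)) refl a b c d α

eval-⊖ : ∀ p q α → eval (p ⊖ q) α ≡ eval p α - eval q α
eval-⊖ (a , b) (c , d) α =
  solve 5 (λ a b c d α → (a :- c) :+ (b :- d) :* α := (a :+ b :* α) :- (c :+ d :* α)) refl a b c d α

eval-⊛ : ∀ c p α → eval (c ⊛ p) α ≡ c * eval p α
eval-⊛ c (a , b) α = solve 4 (λ c a b α → c :* a :+ c :* b :* α := c :* (a :+ b :* α)) refl c a b α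

eval-sumAff : {A : Set} (xs : List A) (f : A → Affine) (α : ℚ) →
              eval (sumAff xs f) α ≡ sumOver xs (λ x → eval (f x) α)
eval-sumAff []       f α = solve 1 (λ α → con 0ℚ :+ con 0ℚ :* α := con 0ℚ) refl α
eval-sumAff (x ∷ xs) f α =
  trans (eval-⊕ (f x) (sumAff xs f) α) (cong (λ s → eval (f x) α + s) (eval-sumAff xs f α))

eval-sumAff-⊛ : {A : Set} (xs : List A) (c : A → ℚ) (f : A → Affine) (α : ℚ) →
                eval (sumAff xs (λ x → c x ⊛ f x)) α ≡ sumOver xs (λ x → c x * eval (f x) α)
eval-sumAff-⊛ xs c f α =
  trans (eval-sumAff xs (λ x → c x ⊛ f x) α) (sumOver-cong xs (λ x → eval-⊛ (c x) (f x) α))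

NonNegativeOn[½,1] : Affine → Set
NonNegativeOn[½,1] p = 0ℚ ≤ eval p ½ × 0ℚ ≤ eval p 1ℚ

nonNegativeOn[½,1]? : ∀ p → Dec (NonNegativeOn[½,1] p)
nonNegativeOn[½,1]? p = 0ℚ ℚ.≤? eval p ½ ×-dec 0ℚ ℚ.≤? eval p 1ℚ

eval-nonNegative : ∀ p {α} → NonNegativeOn[½,1] p → ½ ≤ α → α ≤ 1ℚ → 0ℚ ≤ eval p α
eval-nonNegative (a , b) {α} (0≤p½ , 0≤p1) ½≤α α≤1 =
  subst (0ℚ ≤_) (sym interpolation)
    (ℚP.+-mono-≤ (0≤p*q (0≤q-p α≤1) (0≤p+p 0≤p½)) (0≤p*q (0≤q-p ½≤α) (0≤p+p 0≤p1)))
  where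
  interpolation : a + b * α ≡ (1ℚ - α) * ((a + b * ½) + (a + b * ½))
                            + (α - ½) * ((a + b * 1ℚ) + (a + b * 1ℚ))
  interpolation = solve 3 (λ a b α →
      a :+ b :* α := (con 1ℚ :- α) :* ((a :+ b :* con ½) :+ (a :+ b :* con ½))
                   :+ (α :- con ½) :* ((a :+ b :* con 1ℚ) :+ (a :+ b :* con 1ℚ)))
    refl a b α

module LazyWalkTransport (G : FiniteGraph) (complete : ∀ x → x ∈ FiniteGraph.elems G) where
  open FiniteGraph G
  open GraphNotions G

  /'-via-inverse : ∀ p q → p /' q ≡ p * (1ℚ /' q)
  /'-via-inverse p q with q ℚ.≟ 0ℚ
  ... | yes _ = sym (ℚP.*-zeroʳ p)
  ... | no _  = cong (p *_) (sym (ℚP.*-identityˡ _))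

  /'-one : ∀ p → p /' ℕtoℚ 1 ≡ p
  /'-one p = trans (/'-via-inverse p (ℕtoℚ 1)) (ℚP.*-identityʳ p)

  *-/'-cancelʳ : ∀ p q → q ≢ 0ℚ → (p * q) /' q ≡ p
  *-/'-cancelʳ p q q≢0 with q ℚ.≟ 0ℚ
  ... | yes q≡0 = ⊥-elim (q≢0 q≡0)
  ... | no q≢0′ = begin
    p * q * 1/ q    ≡⟨ ℚP.*-assoc p q _ ⟩
    p * (q * 1/ q)  ≡⟨ cong (p *_) (ℚP.*-inverseʳ q) ⟩
    p * 1ℚ          ≡⟨ ℚP.*-identityʳ p ⟩
    p               ∎
    where instance _ = ℚ.≢-nonZero q≢0′

  μAff : V → V → Affine
  μAff x v = if x == v then (0ℚ , 1ℚ) else (if adj x v then (c , - c) else (0ℚ , 0ℚ))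
    where c = 1ℚ /' ℕtoℚ (deg x)

  μ≡eval-μAff : ∀ α x v → μ α x v ≡ eval (μAff x v) α
  μ≡eval-μAff α x v with x == v | adj x v
  ... | true  | _     = solve 1 (λ α → α := con 0ℚ :+ con 1ℚ :* α) refl α
  ... | false | true  = trans (/'-via-inverse (1ℚ - α) (ℕtoℚ (deg x)))
    (solve 2 (λ α c → (con 1ℚ :- α) :* c := c :+ (:- c) :* α) refl α (1ℚ /' ℕtoℚ (deg x)))
  ... | false | false = solve 1 (λ α → con 0ℚ := con 0ℚ :+ con 0ℚ :* α) refl α

  integral : (V → ℚ) → (V → ℚ) → ℚ
  integral f m = sumV (λ x → f x * m x)

  Lipschitz : (V → ℚ) → Set
  Lipschitz f = ∀ x y → f x - f y ≤ ℕtoℚ (d x y)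

  module _ (f : V → ℚ) {m n : V → ℚ} where

    integral-via-rows : ∀ {π : V → V → ℚ} → (∀ x → sumV (π x) ≡ m x) →
                        integral f m ≡ sumV (λ x → sumV (λ y → f x * π x y))
    integral-via-rows {π} rows = sumOver-cong elems λ x → begin
      f x * m x               ≡⟨ cong (f x *_) (sym (rows x)) ⟩
      f x * sumV (π x)        ≡⟨ *-distribˡ-sumOver (f x) elems (π x) ⟩
      sumV (λ y → f x * π x y) ∎

    integral-via-columns : ∀ {π : V → V → ℚ} → (∀ y → sumV (λ x → π x y) ≡ n y) →
                           integral f n ≡ sumV (λ x → sumV (λ y → f y * π x y))
    integral-via-columns {π} cols = begin
      integral f n                              ≡⟨ sumOver-cong elems (λ y → begin
          f y * n y                                  ≡⟨ cong (f y *_) (sym (cols y)) ⟩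
          f y * sumV (λ x → π x y)                   ≡⟨ *-distribˡ-sumOver (f y) elems (λ x → π x y) ⟩
          sumV (λ x → f y * π x y)                   ∎) ⟩
      sumV (λ y → sumV (λ x → f y * π x y))     ≡⟨ sumOver-comm elems elems (λ y x → f y * π x y) ⟩
      sumV (λ x → sumV (λ y → f y * π x y))     ∎

    kantorovich-bound : ∀ {π : V → V → ℚ} → IsCoupling m n π → Lipschitz f → integral f m - integral f n ≤ cost π
    kantorovich-bound {π} (π≥0 , rows , cols) lip = subst (_≤ cost π) (sym gap≡) gap≤cost
      where
      gap≡ : integral f m - integral f n ≡ sumV (λ x → sumV (λ y → (f x - f y) * π x y))
      gap≡ = begin
        integral f m - integral f n
          ≡⟨ cong₂ _-_ (integral-via-rows rows) (integral-via-columns cols) ⟩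
        sumV (λ x → sumV (λ y → f x * π x y)) - sumV (λ x → sumV (λ y → f y * π x y))
          ≡⟨ sym (sumOver-- elems _ _) ⟩
        sumV (λ x → sumV (λ y → f x * π x y) - sumV (λ y → f y * π x y))
          ≡⟨ sumOver-cong elems (λ x → sym (sumOver-- elems _ _)) ⟩
        sumV (λ x → sumV (λ y → f x * π x y - f y * π x y))
          ≡⟨ sumOver-cong elems (λ x → sumOver-cong elems (λ y →
               solve 3 (λ a b p → a :* p :- b :* p := (a :- b) :* p) refl (f x) (f y) (π x y))) ⟩
        sumV (λ x → sumV (λ y → (f x - f y) * π x y))
          ∎
      gap≤cost : sumV (λ x → sumV (λ y → (f x - f y) * π x y)) ≤ cost π
      gap≤cost = sumOver-mono-≤ elems λ x → sumOver-mono-≤ elems λ y →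
        ℚP.*-monoʳ-≤-nonNeg (π x y) {{ℚ.nonNegative (π≥0 x y)}} (lip x y)

    isW1-of-optimal-pair : ∀ {π : V → V → ℚ} {w} → IsCoupling m n π → cost π ≡ w →
                           Lipschitz f → integral f m - integral f n ≡ w → IsW1 m n w
    isW1-of-optimal-pair {π} coupling cost≡w lip gap≡w =
      (π , coupling , cost≡w) ,
      λ π′ coupling′ → subst (_≤ cost π′) gap≡w (kantorovich-bound coupling′ lip)

  integralAff : (V → ℚ) → V → Affine
  integralAff f x = sumAff elems (λ v → f v ⊛ μAff x v)

  integral-μ : ∀ f α x → integral f (μ α x) ≡ eval (integralAff f x) α
  integral-μ f α x = begin
    sumV (λ v → f v * μ α x v)             ≡⟨ sumOver-cong elems (λ v → cong (f v *_) (μ≡eval-μAff α x v)) ⟩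
    sumV (λ v → f v * eval (μAff x v) α)  ≡⟨ sym (eval-sumAff-⊛ elems f (μAff x) α) ⟩
    eval (integralAff f x) α               ∎

  costAff : (V → V → Affine) → Affine
  costAff P = sumAff elems (λ a → sumAff elems (λ b → ℕtoℚ (d a b) ⊛ P a b))

  cost-eval : ∀ P α → cost (λ a b → eval (P a b) α) ≡ eval (costAff P) α
  cost-eval P α = begin
    sumV (λ a → sumV (λ b → ℕtoℚ (d a b) * eval (P a b) α))
      ≡⟨ sumOver-cong elems (λ a → sym (eval-sumAff-⊛ elems (λ b → ℕtoℚ (d a b)) (P a) α)) ⟩
    sumV (λ a → eval (sumAff elems (λ b → ℕtoℚ (d a b) ⊛ P a b)) α)
      ≡⟨ sym (eval-sumAff elems (λ a → sumAff elems (λ b → ℕtoℚ (d a b) ⊛ P a b)) α) ⟩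
    eval (costAff P) α
      ∎

  marginal-μ : ∀ {α x v} (f : V → Affine) → sumAff elems f ≡ μAff x v →
               sumV (λ b → eval (f b) α) ≡ μ α x v
  marginal-μ {α} {x} {v} f sum≡ = begin
    sumV (λ b → eval (f b) α)  ≡⟨ sym (eval-sumAff elems f α) ⟩
    eval (sumAff elems f) α    ≡⟨ cong (λ p → eval p α) sum≡ ⟩
    eval (μAff x v) α          ≡⟨ sym (μ≡eval-μAff α x v) ⟩
    μ α x v                    ∎

  curvature-from-W1 : ∀ {u w κ δ} → d u w ≡ 1 → 0ℚ < δ →
    (∀ α → 1ℚ - δ < α → α < 1ℚ → IsW1 (μ α u) (μ α w) (1ℚ - κ * (1ℚ - α))) →
    RicciCurvatureIs u w κ
  curvature-from-W1 {u} {w} {κ} {δ} d≡1 0<δ W1≡ ε 0<ε =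
    δ , 0<δ , λ α 1-δ<α α<1 →
      _ , W1≡ α 1-δ<α α<1 , subst (_< ε) (sym (deviation≡0 α (≢-sym (ℚP.<⇒≢ (0<q-p α<1))))) 0<ε
    where
    κα≡ : ∀ α → kappaAlpha u w (1ℚ - κ * (1ℚ - α)) ≡ κ * (1ℚ - α)
    κα≡ α = begin
      1ℚ - (1ℚ - κ * (1ℚ - α)) /' ℕtoℚ (d u w)
        ≡⟨ cong (λ n → 1ℚ - (1ℚ - κ * (1ℚ - α)) /' ℕtoℚ n) d≡1 ⟩
      1ℚ - (1ℚ - κ * (1ℚ - α)) /' ℕtoℚ 1
        ≡⟨ cong (λ x → 1ℚ - x) (/'-one (1ℚ - κ * (1ℚ - α))) ⟩
      1ℚ - (1ℚ - κ * (1ℚ - α))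
        ≡⟨ solve 2 (λ κ α → con 1ℚ :- (con 1ℚ :- κ :* (con 1ℚ :- α)) := κ :* (con 1ℚ :- α)) refl κ α ⟩
      κ * (1ℚ - α)
        ∎
    deviation≡0 : ∀ α → 1ℚ - α ≢ 0ℚ →
                  ∣ kappaAlpha u w (1ℚ - κ * (1ℚ - α)) /' (1ℚ - α) - κ ∣ ≡ 0ℚ
    deviation≡0 α 1-α≢0 = begin
      ∣ kappaAlpha u w (1ℚ - κ * (1ℚ - α)) /' (1ℚ - α) - κ ∣
        ≡⟨ cong (λ x → ∣ x /' (1ℚ - α) - κ ∣) (κα≡ α) ⟩
      ∣ (κ * (1ℚ - α)) /' (1ℚ - α) - κ ∣
        ≡⟨ cong (λ x → ∣ x - κ ∣) (*-/'-cancelʳ κ (1ℚ - α) 1-α≢0) ⟩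
      ∣ κ - κ ∣
        ≡⟨ cong ∣_∣ (ℚP.+-inverseʳ κ) ⟩
      0ℚ
        ∎

  record Certificate : Set where
    field
      plan      : V → V → Affine
      potential : V → ℚ

  AllPairs : (V → V → Set) → Set
  AllPairs R = All (λ a → All (R a) elems) elems

  allPairs? : ∀ {R} → (∀ a b → Dec (R a b)) → Dec (AllPairs R)
  allPairs? R? = all? (λ a → all? (R? a) elems) elems

  lookupPair : ∀ {R} → AllPairs R → ∀ a b → R a b
  lookupPair all a b = All.lookup (All.lookup all (complete a)) (complete b)

  -- Taken at any α ∈ [½, 1], the plan is a coupling of μ_u^α and μ_w^α and the
  -- potential a 1-Lipschitz function, both of value (1 − κ) + κα.
  IsValid : V → V → ℚ → Certificate → Set
  IsValid u w κ c =
    d u w ≡ 1 ×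
    All (λ a → sumAff elems (plan a) ≡ μAff u a) elems ×
    All (λ b → sumAff elems (λ a → plan a b) ≡ μAff w b) elems ×
    AllPairs (λ a b → NonNegativeOn[½,1] (plan a b)) ×
    costAff plan ≡ (1ℚ - κ , κ) ×
    AllPairs (λ a b → potential a - potential b ≤ ℕtoℚ (d a b)) ×
    integralAff potential u ⊖ integralAff potential w ≡ (1ℚ - κ , κ)
    where open Certificate c

  isValid? : ∀ u w κ c → Dec (IsValid u w κ c)
  isValid? u w κ c =
    d u w ℕ.≟ 1 ×-dec
    all? (λ a → sumAff elems (plan a) ≟A μAff u a) elems ×-dec
    all? (λ b → sumAff elems (λ a → plan a b) ≟A μAff w b) elems ×-dec
    allPairs? (λ a b → nonNegativeOn[½,1]? (plan a b)) ×-dec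
    costAff plan ≟A (1ℚ - κ , κ) ×-dec
    allPairs? (λ a b → potential a - potential b ℚ.≤? ℕtoℚ (d a b)) ×-dec
    integralAff potential u ⊖ integralAff potential w ≟A (1ℚ - κ , κ)
    where open Certificate c

  valid⇒curvature : ∀ {u w κ} c → IsValid u w κ c → RicciCurvatureIs u w κ
  valid⇒curvature {u} {w} {κ} c (d≡1 , rows , cols , nonNeg , cost≡ , lipschitz , gap≡) =
    curvature-from-W1 d≡1 (ℚP.positive⁻¹ ½) λ α ½<α α<1 →
      isW1-of-optimal-pair potential (coupling α (ℚP.<⇒≤ ½<α) (ℚP.<⇒≤ α<1))
        (trans (cost-eval plan α) (eval-W₁ cost≡)) (lookupPair lipschitz) (gap≡W₁ α)
    where
    open Certificate c

    eval-W₁ : ∀ {p α} → p ≡ (1ℚ - κ , κ) → eval p α ≡ 1ℚ - κ * (1ℚ - α)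
    eval-W₁ {α = α} refl =
      solve 2 (λ κ α → (con 1ℚ :- κ) :+ κ :* α := con 1ℚ :- κ :* (con 1ℚ :- α)) refl κ α

    coupling : ∀ α → ½ ≤ α → α ≤ 1ℚ → IsCoupling (μ α u) (μ α w) (λ a b → eval (plan a b) α)
    coupling α ½≤α α≤1 =
        (λ a b → eval-nonNegative (plan a b) (lookupPair nonNeg a b) ½≤α α≤1)
      , (λ a → marginal-μ (plan a) (All.lookup rows (complete a)))
      , (λ b → marginal-μ (λ a → plan a b) (All.lookup cols (complete b)))

    gap≡W₁ : ∀ α → integral potential (μ α u) - integral potential (μ α w) ≡ 1ℚ - κ * (1ℚ - α)
    gap≡W₁ α = begin
      integral potential (μ α u) - integral potential (μ α w)
        ≡⟨ cong₂ _-_ (integral-μ potential α u) (integral-μ potential α w) ⟩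
      eval (integralAff potential u) α - eval (integralAff potential w) α
        ≡⟨ sym (eval-⊖ (integralAff potential u) (integralAff potential w) α) ⟩
      eval (integralAff potential u ⊖ integralAff potential w) α
        ≡⟨ eval-W₁ gap≡ ⟩
      1ℚ - κ * (1ℚ - α)
        ∎

∈-Q12-elems : ∀ x → x ∈ Q12-elems
∈-Q12-elems (a , b) = ∈-cartesianProduct⁺ (∈-allFin a) (∈-allFin b)

open GraphNotions ΓQ12 using (RicciCurvatureIs)
open LazyWalkTransport ΓQ12 ∈-Q12-elems

e : Q12
e = (zero , zero)

-- μ_x^α puts (1 − α)/4 on each neighbour; the endpoint x of an edge keeps that
-- much of its own mass α and sends the rest, (5α − 1)/4, across the edge.
neighbourShare surplus : Affine
neighbourShare = (+ 1 / 4 , - (+ 1 / 4))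
surplus        = (- (+ 1 / 4) , + 5 / 4)

Move : Set
Move = Q12 × Q12 × Affine

lookupMove : List Move → Q12 → Q12 → Affine
lookupMove []                 a b = (0ℚ , 0ℚ)
lookupMove ((x , y , m) ∷ ms) a b =
  if does (x ≟Q a) ∧ does (y ≟Q b) then m else lookupMove ms a b

levelPotential : List Q12 → List Q12 → Q12 → ℚ
levelPotential high low v =
  if any (λ x → does (x ≟Q v)) high then 1ℚ
  else if any (λ x → does (x ≟Q v)) low then - 1ℚ
  else 0ℚ

-- Plan and potential for the edge {e, s}.
record EdgeTemplate : Set where
  field
    moves    : List Move
    high low : List Q12

translate : Q12 → EdgeTemplate → Certificate
translate g t = record
  { plan      = lookupMove (map (λ (x , y , m) → g · x , g · y , m) moves)
  ; potential = levelPotential (map (g ·_) high) (map (g ·_) low)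
  }
  where open EdgeTemplate t

σ-template : EdgeTemplate
σ-template = record
  { moves = (e , e , neighbourShare) ∷ (e , σ , surplus) ∷ (σ , σ , neighbourShare)
          ∷ (σ⁻¹ , σ · σ , neighbourShare) ∷ (τ , σ · τ , neighbourShare)
          ∷ (τ⁻¹ , σ · τ⁻¹ , neighbourShare) ∷ []
  ; high  = e ∷ σ⁻¹ ∷ []
  ; low   = σ · σ ∷ σ · τ ∷ σ · τ⁻¹ ∷ []
  }

τ-template : EdgeTemplate
τ-template = record
  { moves = (e , e , neighbourShare) ∷ (e , τ , surplus) ∷ (τ , τ , neighbourShare)
          ∷ (σ , σ · τ , neighbourShare) ∷ (σ⁻¹ , σ⁻¹ · τ , neighbourShare)
          ∷ (τ⁻¹ , τ · τ , neighbourShare) ∷ []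
  ; high  = e ∷ []
  ; low   = σ · τ ∷ σ⁻¹ · τ ∷ τ · τ ∷ []
  }

curvature-of-translates : ∀ s κ t →
  All (λ g → True (isValid? g (g · s) κ (translate g t))) Q12-elems →
  ∀ g → RicciCurvatureIs g (g · s) κ
curvature-of-translates s κ t valid g =
  valid⇒curvature {g} {g · s} {κ} (translate g t)
    (toWitness {a? = isValid? g (g · s) κ (translate g t)} (All.lookup valid (∈-Q12-elems g)))

proposition6 : (∀ g → GraphNotions.RicciCurvatureIs ΓQ12 g (g · σ) ((+ 1) / 4))
    × (∀ g → GraphNotions.RicciCurvatureIs ΓQ12 g (g · τ) ((+ 1) / 2))
proposition6 =
    curvature-of-translates σ ((+ 1) / 4) σ-template (_ ∷ _ ∷ _ ∷ _ ∷ _ ∷ _ ∷ _ ∷ _ ∷ _ ∷ _ ∷ _ ∷ _ ∷ [])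
  , curvature-of-translates τ ((+ 1) / 2) τ-template (_ ∷ _ ∷ _ ∷ _ ∷ _ ∷ _ ∷ _ ∷ _ ∷ _ ∷ _ ∷ _ ∷ _ ∷ [])
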